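{- Let $f:\mathbb{F}_{2^n}\to\mathbb{F}_{2^n}$ be an APN function and $A:\mathbb{F}_{2^n}\to\mathbb{F}_{2^n}$ an affine function. Then $|\mathcal{G}_f\cap\mathcal{G}_A|\leq\sqrt{2}\cdot2^{n/2}+\frac12$.
   Context: $f$ is APN (almost perfect nonlinear) if for all $a\neq0$ and all $b$, the equation $f(x+a)+f(x)=b$ has at most $2$ solutions $x$. The graph of $g$ is $\mathcal{G}_g=\{(x,g(x)) : x\in\mathbb{F}_{2^n}\}$. An affine function is an $\mathbb{F}_2$-linear map plus a constant. -}

module Defs where

open import Data.Nat using (ℕ; zero; suc; _≤_)
open import Data.Bool using (Bool; true; false; _xor_)
import Data.Bool.Properties as BP
open import Data.Vec using (Vec; []; _∷_; zipWith; replicate)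
import Data.Vec.Properties as VP
open import Data.List using (List; []; _∷_; map; _++_; filter; length)
open import Relation.Binary.PropositionalEquality using (_≡_)
open import Relation.Binary.Definitions using (DecidableEquality)
open import Relation.Nullary using (¬_)
open import Data.Product using (Σ; _×_)

-- The additive group of F_{2^n}: F_2^n, elements as bit vectors, addition = XOR.
-- (Only the additive / F_2-vector-space structure of F_{2^n} is used by the statement.)
F : ℕ → Set
F n = Vec Bool n

_⊕_ : ∀ {n} → F n → F n → F n
_⊕_ = zipWith _xor_

𝟘 : ∀ {n} → F n
𝟘 = replicate _ false

_≟F_ : ∀ {n} → DecidableEquality (F n)
_≟F_ = VP.≡-dec BP._≟_

allF : (n : ℕ) → List (F n)
allF zero = [] ∷ []
allF (suc n) = map (false ∷_) (allF n) ++ map (true ∷_) (allF n)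

graphInter : ∀ {n} → (F n → F n) → (F n → F n) → ℕ
graphInter {n} f g = length (filter (λ x → f x ≟F g x) (allF n))

nSol : ∀ {n} → (F n → F n) → F n → F n → ℕ
nSol {n} f a b = length (filter (λ x → (f (x ⊕ a) ⊕ f x) ≟F b) (allF n))

APN : ∀ {n} → (F n → F n) → Set
APN {n} f = ∀ (a : F n) → ¬ (a ≡ 𝟘) → ∀ (b : F n) → nSol f a b ≤ 2

-- F_2-linear: additive (scalar multiplication by F_2 = {0,1} is then automatic)
Linear : ∀ {n} → (F n → F n) → Set
Linear {n} L = ∀ (x y : F n) → L (x ⊕ y) ≡ L x ⊕ L y

Affine : ∀ {n} → (F n → F n) → Set
Affine {n} A = Σ (F n → F n) λ L → Linear L × Σ (F n) λ c → ∀ x → A x ≡ L x ⊕ c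

{-# OPTIONS --safe #-}
-- Let S = {x : f x = A x} and k = |S|.  Count the k² ordered pairs (x, y) ∈ S × S by
-- their difference a = x + y.  For a = 0 there are k of them.  For a ≠ 0, both points
-- lie on the graph of A, so f(x + a) + f(x) = A(x + a) + A(x) = L a, where L is the
-- linear part of A.  Since f is APN, at most 2 values of x satisfy this.  Hence
-- k² ≤ k + 2(2ⁿ − 1), which rearranges to (2k − 1)² ≤ 2ⁿ⁺³ − 7.
module Submission where

open import Defs
open import Data.Nat using (ℕ; _≤_; _*_; _∸_; _^_; _+_; zero; suc; z≤n)
open import Data.Nat.Properties
open import Data.Nat.ListAction using (sum)
open import Data.Nat.ListAction.Properties using (sum-++)
open import Data.Nat.Solver using (module +-*-Solver)
open +-*-Solver using (solve; _:=_; _:+_; _:*_; _:^_; con)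
open import Data.Bool using (true; false; _xor_; if_then_else_)
open import Data.Vec using ([]; _∷_)
open import Data.List using (List; []; _∷_; map; _++_; filter; length)
open import Data.List.Properties using (map-++; map-∘; map-cong)
open import Data.Product using (_,_)
open import Function using (_∘_)
open import Relation.Nullary using (Dec; does; yes; no)
open import Relation.Unary using (Pred; Decidable)
open import Relation.Binary.PropositionalEquality
open import Level using (Level)

private
  variable
    ℓ ℓ′ : Level
    X : Set ℓ
    Y : Set ℓ′

∑ : List X → (X → ℕ) → ℕ
∑ xs h = sum (map h xs)

infix 5 ∑
syntax ∑ xs (λ x → e) = ∑[ x ∈ xs ] e

∑-++ : ∀ (xs ys : List X) h → ∑ (xs ++ ys) h ≡ ∑ xs h + ∑ ys h
∑-++ xs ys h = trans (cong sum (map-++ h xs ys)) (sum-++ (map h xs) (map h ys))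

∑-map : ∀ (g : Y → X) (ys : List Y) h → ∑ (map g ys) h ≡ ∑ ys (h ∘ g)
∑-map g ys h = cong sum (sym (map-∘ ys))

∑-cong : ∀ (xs : List X) {h g : X → ℕ} → (∀ x → h x ≡ g x) → ∑ xs h ≡ ∑ xs g
∑-cong xs h≗g = cong sum (map-cong h≗g xs)

∑-mono : ∀ (xs : List X) {h g : X → ℕ} → (∀ x → h x ≤ g x) → ∑ xs h ≤ ∑ xs g
∑-mono []       h≤g = z≤n
∑-mono (x ∷ xs) h≤g = +-mono-≤ (h≤g x) (∑-mono xs h≤g)

∑-zero : ∀ (xs : List X) → ∑[ x ∈ xs ] 0 ≡ 0
∑-zero []       = refl
∑-zero (x ∷ xs) = ∑-zero xs

∑-distrib-+ : ∀ (xs : List X) h g → ∑[ x ∈ xs ] (h x + g x) ≡ ∑ xs h + ∑ xs g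
∑-distrib-+ []       h g = refl
∑-distrib-+ (x ∷ xs) h g = trans (cong (h x + g x +_) (∑-distrib-+ xs h g))
  (solve 4 (λ a b c d → (a :+ b) :+ (c :+ d) := (a :+ c) :+ (b :+ d)) refl
    (h x) (g x) (∑ xs h) (∑ xs g))

∑-distribˡ-* : ∀ (xs : List X) h c → ∑[ x ∈ xs ] (c * h x) ≡ c * ∑ xs h
∑-distribˡ-* []       h c = sym (*-zeroʳ c)
∑-distribˡ-* (x ∷ xs) h c =
  trans (cong (c * h x +_) (∑-distribˡ-* xs h c)) (sym (*-distribˡ-+ c (h x) (∑ xs h)))

∑-distribʳ-* : ∀ (xs : List X) h c → ∑[ x ∈ xs ] (h x * c) ≡ ∑ xs h * c
∑-distribʳ-* []       h c = refl
∑-distribʳ-* (x ∷ xs) h c =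
  trans (cong (h x * c +_) (∑-distribʳ-* xs h c)) (sym (*-distribʳ-+ c (h x) (∑ xs h)))

∑-comm : ∀ (xs : List X) (ys : List Y) (h : X → Y → ℕ) →
         ∑[ x ∈ xs ] ∑[ y ∈ ys ] h x y ≡ ∑[ y ∈ ys ] ∑[ x ∈ xs ] h x y
∑-comm []       ys h = sym (∑-zero ys)
∑-comm (x ∷ xs) ys h = trans (cong (∑ ys (h x) +_) (∑-comm xs ys h))
  (sym (∑-distrib-+ ys (h x) (λ y → ∑[ x ∈ xs ] h x y)))

𝟙 : ∀ {p} {P : Set p} → Dec P → ℕ
𝟙 (yes _) = 1
𝟙 (no _)  = 0

𝟙-*-≤ : ∀ {p q r} {P : Set p} {Q : Set q} {R : Set r} (P? : Dec P) (Q? : Dec Q) (R? : Dec R) →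
        (P → Q → R) → 𝟙 P? * 𝟙 Q? ≤ 𝟙 R?
𝟙-*-≤ (yes _) (yes _) (yes _) _     = ≤-refl
𝟙-*-≤ (yes p) (yes q) (no ¬r) p→q→r with () ← ¬r (p→q→r p q)
𝟙-*-≤ (yes _) (no _)  _       _     = z≤n
𝟙-*-≤ (no _)  _       _       _     = z≤n

length-filter : ∀ {p} {P : Pred X p} (P? : Decidable P) (xs : List X) →
                length (filter P? xs) ≡ ∑[ x ∈ xs ] 𝟙 (P? x)
length-filter P? []       = refl
length-filter P? (x ∷ xs) with P? x
... | yes _ = cong suc (length-filter P? xs)
... | no  _ = length-filter P? xs

∑-allF-suc : ∀ n (h : F (suc n) → ℕ) →
             ∑ (allF (suc n)) h ≡ (∑[ x ∈ allF n ] h (false ∷ x)) + (∑[ x ∈ allF n ] h (true ∷ x))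
∑-allF-suc n h = trans (∑-++ (map (false ∷_) (allF n)) _ h)
  (cong₂ _+_ (∑-map (false ∷_) (allF n) h) (∑-map (true ∷_) (allF n) h))

∑-allF-const : ∀ n m → ∑[ x ∈ allF n ] m ≡ m * 2 ^ n
∑-allF-const zero    m = trans (+-identityʳ m) (sym (*-identityʳ m))
∑-allF-const (suc n) m = begin
  ∑[ x ∈ allF (suc n) ] m                     ≡⟨ ∑-allF-suc n (λ _ → m) ⟩
  (∑[ x ∈ allF n ] m) + (∑[ x ∈ allF n ] m)   ≡⟨ cong₂ _+_ (∑-allF-const n m) (∑-allF-const n m) ⟩
  m * 2 ^ n + m * 2 ^ n                       ≡⟨ solve 2 (λ m p → m :* p :+ m :* p := m :* (con 2 :* p)) refl m (2 ^ n) ⟩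
  m * 2 ^ suc n                               ∎
  where open ≡-Reasoning

∑-allF-translate : ∀ n (y : F n) (h : F n → ℕ) → ∑ (allF n) h ≡ ∑[ x ∈ allF n ] h (y ⊕ x)
∑-allF-translate zero    []      h = refl
∑-allF-translate (suc n) (b ∷ y) h = begin
  ∑ (allF (suc n)) h
    ≡⟨ ∑-allF-suc n h ⟩
  (∑[ x ∈ allF n ] h (false ∷ x)) + (∑[ x ∈ allF n ] h (true ∷ x))
    ≡⟨ cong₂ _+_ (∑-allF-translate n y _) (∑-allF-translate n y _) ⟩
  (∑[ x ∈ allF n ] h (false ∷ y ⊕ x)) + (∑[ x ∈ allF n ] h (true ∷ y ⊕ x))
    ≡⟨ swap-halves b ⟩
  (∑[ x ∈ allF n ] h ((b xor false) ∷ y ⊕ x)) + (∑[ x ∈ allF n ] h ((b xor true) ∷ y ⊕ x))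
    ≡⟨ ∑-allF-suc n (λ x → h ((b ∷ y) ⊕ x)) ⟨
  ∑[ x ∈ allF (suc n) ] h ((b ∷ y) ⊕ x)
    ∎
  where
  open ≡-Reasoning
  swap-halves : ∀ b → (∑[ x ∈ allF n ] h (false ∷ y ⊕ x)) + (∑[ x ∈ allF n ] h (true ∷ y ⊕ x))
                    ≡ (∑[ x ∈ allF n ] h ((b xor false) ∷ y ⊕ x)) + (∑[ x ∈ allF n ] h ((b xor true) ∷ y ⊕ x))
  swap-halves false = refl
  swap-halves true  = +-comm (∑[ x ∈ allF n ] h (false ∷ y ⊕ x)) _

autocorrelation : ∀ {n} → (F n → ℕ) → F n → ℕ
autocorrelation {n} h a = ∑[ x ∈ allF n ] h x * h (x ⊕ a)

∑-autocorrelation : ∀ n (h : F n → ℕ) → ∑ (allF n) (autocorrelation h) ≡ ∑ (allF n) h * ∑ (allF n) h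
∑-autocorrelation n h = begin
  ∑[ a ∈ U ] ∑[ x ∈ U ] h x * h (x ⊕ a)    ≡⟨ ∑-comm U U (λ a x → h x * h (x ⊕ a)) ⟩
  ∑[ x ∈ U ] ∑[ a ∈ U ] h x * h (x ⊕ a)    ≡⟨ ∑-cong U (λ x → ∑-distribˡ-* U (λ a → h (x ⊕ a)) (h x)) ⟩
  ∑[ x ∈ U ] h x * (∑[ a ∈ U ] h (x ⊕ a))  ≡⟨ ∑-cong U (λ x → cong (h x *_) (∑-allF-translate n x h)) ⟨
  ∑[ x ∈ U ] h x * ∑ U h                   ≡⟨ ∑-distribʳ-* U h (∑ U h) ⟩
  ∑ U h * ∑ U h                            ∎
  where
  open ≡-Reasoning
  U = allF n

∑-allF-𝟘-or : ∀ n k m → (∑[ a ∈ allF n ] (if does (a ≟F 𝟘) then k else m)) + m ≡ k + m * 2 ^ n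
∑-allF-𝟘-or zero    k m = cong₂ _+_ (+-identityʳ k) (sym (*-identityʳ m))
∑-allF-𝟘-or (suc n) k m = begin
  ∑ (allF (suc n)) g + m                     ≡⟨ cong (_+ m) (∑-allF-suc n g) ⟩
  ∑ (allF n) g + (∑[ a ∈ allF n ] m) + m     ≡⟨ cong (λ s → ∑ (allF n) g + s + m) (∑-allF-const n m) ⟩
  ∑ (allF n) g + m * 2 ^ n + m               ≡⟨ solve 3 (λ s p m → s :+ p :+ m := s :+ m :+ p) refl (∑ (allF n) g) (m * 2 ^ n) m ⟩
  ∑ (allF n) g + m + m * 2 ^ n               ≡⟨ cong (_+ m * 2 ^ n) (∑-allF-𝟘-or n k m) ⟩
  k + m * 2 ^ n + m * 2 ^ n                  ≡⟨ solve 3 (λ k m p → k :+ m :* p :+ m :* p := k :+ m :* (con 2 :* p)) refl k m (2 ^ n) ⟩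
  k + m * 2 ^ suc n                          ∎
  where
  open ≡-Reasoning
  g : ∀ {n} → F n → ℕ
  g a = if does (a ≟F 𝟘) then k else m

⊕-cancel : ∀ {n} (u v w : F n) → ((u ⊕ v) ⊕ w) ⊕ (u ⊕ w) ≡ v
⊕-cancel []       []       []       = refl
⊕-cancel (a ∷ u) (b ∷ v) (c ∷ w) = cong₂ _∷_ (xor-cancel a b c) (⊕-cancel u v w)
  where
  xor-cancel : ∀ a b c → ((a xor b) xor c) xor (a xor c) ≡ b
  xor-cancel false false false = refl
  xor-cancel false false true  = refl
  xor-cancel false true  false = refl
  xor-cancel false true  true  = refl
  xor-cancel true  false false = refl
  xor-cancel true  false true  = refl
  xor-cancel true  true  false = refl
  xor-cancel true  true  true  = refl

affine-derivative : ∀ {n} {A L : F n → F n} {c : F n} → Linear L → (∀ x → A x ≡ L x ⊕ c) →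
                    ∀ a x → A (x ⊕ a) ⊕ A x ≡ L a
affine-derivative {A = A} {L} {c} linear A≡ a x = begin
  A (x ⊕ a) ⊕ A x                  ≡⟨ cong₂ _⊕_ (A≡ (x ⊕ a)) (A≡ x) ⟩
  (L (x ⊕ a) ⊕ c) ⊕ (L x ⊕ c)      ≡⟨ cong (λ y → (y ⊕ c) ⊕ (L x ⊕ c)) (linear x a) ⟩
  ((L x ⊕ L a) ⊕ c) ⊕ (L x ⊕ c)    ≡⟨ ⊕-cancel (L x) (L a) c ⟩
  L a                              ∎
  where open ≡-Reasoning

autocorrelation-𝟙-≤ : ∀ {n p} {P : Pred (F n) p} (P? : Decidable P) a →
                      autocorrelation (𝟙 ∘ P?) a ≤ ∑ (allF n) (𝟙 ∘ P?)
autocorrelation-𝟙-≤ {n} P? a = ∑-mono (allF n) (λ x → 𝟙-*-≤ (P? x) (P? (x ⊕ a)) (P? x) (λ p _ → p))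

autocorrelation-agreement-≤-nSol : ∀ {n} (f g : F n → F n) a b → (∀ x → g (x ⊕ a) ⊕ g x ≡ b) →
                                   autocorrelation (λ x → 𝟙 (f x ≟F g x)) a ≤ nSol f a b
autocorrelation-agreement-≤-nSol {n} f g a b Δg≡b = begin
  autocorrelation (λ x → 𝟙 (f x ≟F g x)) a
    ≤⟨ ∑-mono (allF n) (λ x → 𝟙-*-≤ (f x ≟F g x) (f (x ⊕ a) ≟F g (x ⊕ a)) ((f (x ⊕ a) ⊕ f x) ≟F b)
                                   (λ fx≡gx fx⊕a≡gx⊕a → trans (cong₂ _⊕_ fx⊕a≡gx⊕a fx≡gx) (Δg≡b x))) ⟩
  ∑[ x ∈ allF n ] 𝟙 ((f (x ⊕ a) ⊕ f x) ≟F b)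
    ≡⟨ length-filter (λ x → (f (x ⊕ a) ⊕ f x) ≟F b) (allF n) ⟨
  nSol f a b
    ∎
  where open ≤-Reasoning

graphInter-square-bound : ∀ n (f A : F n → F n) → APN f → Affine A →
                          graphInter f A * graphInter f A + 2 ≤ graphInter f A + 2 * 2 ^ n
graphInter-square-bound n f A apn (L , linear , c , A≡) = begin
  k * k + 2                                              ≡⟨ cong (λ s → s * s + 2) k≡∑ ⟩
  ∑ U χ * ∑ U χ + 2                                      ≡⟨ cong (_+ 2) (∑-autocorrelation n χ) ⟨
  ∑ U (autocorrelation χ) + 2                            ≤⟨ +-monoˡ-≤ 2 (∑-mono U autocorrelation-bound) ⟩
  (∑[ a ∈ U ] (if does (a ≟F 𝟘) then k else 2)) + 2     ≡⟨ ∑-allF-𝟘-or n k 2 ⟩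
  k + 2 * 2 ^ n                                          ∎
  where
  open ≤-Reasoning
  U = allF n
  k = graphInter f A
  χ : F n → ℕ
  χ x = 𝟙 (f x ≟F A x)
  k≡∑ : k ≡ ∑ U χ
  k≡∑ = length-filter (λ x → f x ≟F A x) U
  autocorrelation-bound : ∀ a → autocorrelation χ a ≤ (if does (a ≟F 𝟘) then k else 2)
  autocorrelation-bound a with a ≟F 𝟘
  ... | yes _   = ≤-trans (autocorrelation-𝟙-≤ (λ x → f x ≟F A x) a) (≤-reflexive (sym k≡∑))
  ... | no  a≢𝟘 = ≤-trans (autocorrelation-agreement-≤-nSol f A a (L a) (affine-derivative linear A≡ a))
                          (apn a a≢𝟘 (L a))

square-bound : ∀ k P → k * k + 2 ≤ k + 2 * P → (2 * k ∸ 1) ^ 2 ≤ P * 8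
square-bound zero    P _ = z≤n
square-bound (suc m) P h = ≤-trans (m≤m+n _ 7) (+-cancelʳ-≤ (4 * suc m) _ _ (begin
  ((2 * suc m ∸ 1) ^ 2 + 7) + 4 * suc m   ≡⟨ cong (λ j → (j ^ 2 + 7) + 4 * suc m) odd ⟩
  ((2 * m + 1) ^ 2 + 7) + 4 * suc m       ≡⟨ solve 1 (λ m → ((con 2 :* m :+ con 1) :^ 2 :+ con 7) :+ con 4 :* (con 1 :+ m)
                                                         := con 4 :* ((con 1 :+ m) :* (con 1 :+ m) :+ con 2)) refl m ⟩
  4 * (suc m * suc m + 2)                 ≤⟨ *-monoʳ-≤ 4 h ⟩
  4 * (suc m + 2 * P)                     ≡⟨ solve 2 (λ m P → con 4 :* (con 1 :+ m :+ con 2 :* P)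
                                                         := P :* con 8 :+ con 4 :* (con 1 :+ m)) refl m P ⟩
  P * 8 + 4 * suc m                       ∎))
  where
  open ≤-Reasoning
  odd : 2 * suc m ∸ 1 ≡ 2 * m + 1
  odd = solve 1 (λ m → m :+ (con 1 :+ (m :+ con 0)) := con 2 :* m :+ con 1) refl m

lemma5 : (n : ℕ) (f A : F n → F n) → APN f → Affine A →
    (2 * graphInter f A ∸ 1) ^ 2 ≤ 2 ^ (n + 3)
lemma5 n f A apn affine = begin
  (2 * graphInter f A ∸ 1) ^ 2  ≤⟨ square-bound (graphInter f A) (2 ^ n) (graphInter-square-bound n f A apn affine) ⟩
  2 ^ n * 2 ^ 3                 ≡⟨ ^-distribˡ-+-* 2 n 3 ⟨
  2 ^ (n + 3)                   ∎
  where open ≤-Reasoning
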